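{- Let $H$ be a connected $n$-vertex $r$-graph. If $\ell(H)+1\le c(H)$, then $n=c(H)$.
   Context: An $r$-graph is a simple $r$-uniform hypergraph. A Berge path of length $t$ consists of $t+1$ distinct vertices $v_0,\dots,v_t$ and $t$ distinct edges $e_1,\dots,e_t$ with $\{v_{i-1},v_i\}\subseteq e_i$ for $1\le i\le t$. A Berge cycle of length $t$ consists of $t$ distinct vertices $v_1,\dots,v_t$ and $t$ distinct edges $e_1,\dots,e_t$ with $\{v_{i-1},v_i\}\subseteq e_i$, indices modulo $t$. $H$ is connected if any two vertices are joined by a Berge path. $\ell(H)$ (resp. $c(H)$) denotes the length of a longest Berge path (resp. Berge cycle) in $H$. -}

module Defs where

open import Data.Nat using (ℕ; zero; suc; _≤_)
open import Data.Fin using (Fin; zero; suc; inject₁; fromℕ)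
open import Data.Fin.Subset using (Subset; ∣_∣) renaming (_∈_ to _∈ₛ_)
open import Data.List using (List)
open import Data.List.Membership.Propositional using () renaming (_∈_ to _∈ₗ_)
open import Data.List.Relation.Unary.All using (All)
open import Data.List.Relation.Unary.Unique.Propositional using (Unique)
open import Data.Product using (Σ; ∃; _×_)
open import Function.Definitions using (Injective)
open import Relation.Binary.PropositionalEquality using (_≡_)

record RGraph (n r : ℕ) : Set where
  field
    edges   : List (Subset n)
    uniform : All (λ e → ∣ e ∣ ≡ r) edges
    simple  : Unique edges
open RGraph public

record BergePath {n r : ℕ} (H : RGraph n r) (t : ℕ) : Set where
  field
    vtx      : Fin (suc t) → Fin n
    edg      : Fin t → Subset n
    vtx-inj  : Injective _≡_ _≡_ vtx
    edg-inj  : Injective _≡_ _≡_ edg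
    edg-in   : ∀ i → edg i ∈ₗ edges H
    left∈    : ∀ i → vtx (inject₁ i) ∈ₛ edg i
    right∈   : ∀ i → vtx (suc i) ∈ₛ edg i
open BergePath public

-- A Berge cycle of length t = suc k (t ≥ 2 required): distinct vertices
-- v 0 … v k, distinct edges e 0 … e k of H, with {v i, v (i+1)} ⊆ e i for
-- i < k and {v k, v 0} ⊆ e k (indices modulo t).
record BergeCycle {n r : ℕ} (H : RGraph n r) (t : ℕ) : Set where
  field
    k        : ℕ
    len      : t ≡ suc k
    len≥2    : 2 ≤ t
    cvtx     : Fin (suc k) → Fin n
    cedg     : Fin (suc k) → Subset n
    cvtx-inj : Injective _≡_ _≡_ cvtx
    cedg-inj : Injective _≡_ _≡_ cedg
    cedg-in  : ∀ i → cedg i ∈ₗ edges H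
    cleft∈   : ∀ (i : Fin k) → cvtx (inject₁ i) ∈ₛ cedg (inject₁ i)
    cright∈  : ∀ (i : Fin k) → cvtx (suc i) ∈ₛ cedg (inject₁ i)
    close₁   : cvtx (fromℕ k) ∈ₛ cedg (fromℕ k)
    close₂   : cvtx zero ∈ₛ cedg (fromℕ k)

Connected : {n r : ℕ} → RGraph n r → Set
Connected {n} H = ∀ (u w : Fin n) → ∃ λ t → Σ (BergePath H t) λ P →
  (vtx P zero ≡ u) × (vtx P (fromℕ t) ≡ w)

IsLongestPathLength : {n r : ℕ} → RGraph n r → ℕ → Set
IsLongestPathLength H L = BergePath H L × (∀ t → BergePath H t → t ≤ L)

-- c(H) = C (for C ≥ 1): C is the length of a longest Berge cycle.
-- (If H has no Berge cycle, c(H) = 0 and no C ≥ 1 satisfies this.)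
IsLongestCycleLength : {n r : ℕ} → RGraph n r → ℕ → Set
IsLongestCycleLength H C = BergeCycle H C × (∀ t → BergeCycle H t → t ≤ C)

module Submission where

-- Suppose some vertex u is off C, and let C have length k + 1.  A Berge
-- path from u to C has an edge e joining a vertex w off C to a vertex v
-- on C.  Going around C from a suitable start along k of its edges and
-- prefixing w and e gives a Berge path of length k + 1 = c(H) > ℓ(H):
--   * if e is not an edge of C, start at v;
--   * if e is the edge of C between positions j and j + 1, start at
--     j + 1, so that e is exactly the edge of C left out.  If every vertex lies on C, its vertex map is a bijection.

open import Defs
open import Data.Nat using (ℕ; zero; suc; _+_; _≤_; _<_; s≤s)
open import Data.Nat.Properties using (+-comm; <⇒≤; <⇒≱)
open import Data.Fin using (Fin; zero; suc; toℕ; fromℕ; fromℕ<; inject₁)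
open import Data.Fin.Properties
  using (suc-injective; toℕ-injective; toℕ-fromℕ<; toℕ-inject₁; fromℕ<-toℕ; toℕ<n;
         inject₁-injective; any?; all?; ¬∀⟶∃¬; cantor-schröder-bernstein)
  renaming (_≟_ to _≟ᶠ_)
open import Data.Fin.Subset using (Subset) renaming (_∈_ to _∈ₛ_)
open import Data.Bool.Properties using () renaming (_≟_ to _≟ᵇ_)
open import Data.Vec.Properties using (≡-dec)
open import Data.List.Membership.Propositional using () renaming (_∈_ to _∈ₗ_)
open import Data.Product using (Σ; ∃; _×_; _,_; proj₁; proj₂)
open import Data.Sum using (_⊎_; inj₁; inj₂)
open import Data.Empty using (⊥-elim)
open import Relation.Nullary using (¬_; Dec; yes; no)
open import Function.Definitions using (Injective)
open import Relation.Binary.PropositionalEquality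

data LastView : {k : ℕ} → Fin (suc k) → Set where
  last  : ∀ {k} → LastView (fromℕ k)
  inner : ∀ {k} (i : Fin k) → LastView (inject₁ i)

lastView : ∀ {k} (j : Fin (suc k)) → LastView j
lastView {zero}  zero    = last
lastView {suc k} zero    = inner zero
lastView {suc k} (suc j) with lastView j
... | last    = last
... | inner i = inner (suc i)

lastView-inject₁ : ∀ {k} (i : Fin k) → lastView (inject₁ i) ≡ inner i
lastView-inject₁ zero    = refl
lastView-inject₁ (suc i) rewrite lastView-inject₁ i = refl

next : ∀ {k} → Fin (suc k) → Fin (suc k)
next j with lastView j
... | last    = zero
... | inner i = suc i

next-inject₁ : ∀ {k} (i : Fin k) → next (inject₁ i) ≡ suc i
next-inject₁ i rewrite lastView-inject₁ i = refl

next-injective : ∀ {k} → Injective _≡_ _≡_ (next {k})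
next-injective {x = i} {y = j} eq with lastView i | lastView j
... | last    | last    = refl
... | inner a | inner b = cong inject₁ (suc-injective eq)

record Rotation (k : ℕ) : Set where
  field
    ρ      : Fin (suc k) → Fin (suc k)
    ρ-inj  : Injective _≡_ _≡_ ρ
    ρ-next : ∀ x → ρ (next x) ≡ next (ρ x)
open Rotation

rotateBy : ∀ {k} → ℕ → Rotation k
rotateBy zero    = record { ρ = λ x → x ; ρ-inj = λ eq → eq ; ρ-next = λ _ → refl }
rotateBy (suc m) = record
  { ρ      = λ x → next (ρ R x)
  ; ρ-inj  = λ eq → ρ-inj R (next-injective eq)
  ; ρ-next = λ x → cong next (ρ-next R x)
  }
  where R = rotateBy m

rotateBy-zero : ∀ {k} m (m<k+1 : m < suc k) → ρ (rotateBy m) zero ≡ fromℕ< m<k+1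
rotateBy-zero zero        _         = refl
rotateBy-zero {k} (suc m) (s≤s m<k) = begin
  next (ρ (rotateBy m) zero)  ≡⟨ cong next (rotateBy-zero m (s≤s (<⇒≤ m<k))) ⟩
  next (fromℕ< _)             ≡⟨ cong next embed ⟩
  next (inject₁ (fromℕ< m<k)) ≡⟨ next-inject₁ (fromℕ< m<k) ⟩
  suc (fromℕ< m<k)            ∎
  where
  open ≡-Reasoning
  embed : fromℕ< {m} {suc k} (s≤s (<⇒≤ m<k)) ≡ inject₁ (fromℕ< m<k)
  embed = toℕ-injective
    (trans (toℕ-fromℕ< _) (sym (trans (toℕ-inject₁ _) (toℕ-fromℕ< m<k))))

rotationTo : ∀ {k} (j : Fin (suc k)) → Σ (Rotation k) λ R → ρ R zero ≡ j
rotationTo j = rotateBy (toℕ j) , trans (rotateBy-zero (toℕ j) (toℕ<n j)) (fromℕ<-toℕ j _)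

firstEntry : ∀ {A : Set} {P : A → Set} → (∀ x → Dec (P x)) →
  ∀ t (f : Fin (suc t) → A) → ¬ P (f zero) → P (f (fromℕ t)) →
  ∃ λ (i : Fin t) → ¬ P (f (inject₁ i)) × P (f (suc i))
firstEntry P? zero    f outside inside = ⊥-elim (outside inside)
firstEntry P? (suc t) f outside inside with P? (f (suc zero))
... | yes p = zero , outside , p
... | no ¬p with firstEntry P? t (λ i → f (suc i)) ¬p inside
...   | i , off , on = suc i , off , on

record IndexedCycle {n r : ℕ} (H : RGraph n r) (k : ℕ) : Set where
  field
    vertexAt     : Fin (suc k) → Fin n
    edgeAt       : Fin (suc k) → Subset n
    vertexAt-inj : Injective _≡_ _≡_ vertexAt
    edgeAt-inj   : Injective _≡_ _≡_ edgeAt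
    edgeAt-in    : ∀ j → edgeAt j ∈ₗ edges H
    here∈        : ∀ j → vertexAt j ∈ₛ edgeAt j
    next∈        : ∀ j → vertexAt (next j) ∈ₛ edgeAt j
open IndexedCycle

module _ {n r : ℕ} {H : RGraph n r} where

  indexCycle : ∀ {t} (C : BergeCycle H t) → IndexedCycle H (BergeCycle.k C)
  indexCycle C = record
    { vertexAt = cvtx ; edgeAt = cedg ; vertexAt-inj = cvtx-inj ; edgeAt-inj = cedg-inj
    ; edgeAt-in = cedg-in ; here∈ = here ; next∈ = there }
    where
    open BergeCycle C
    here : ∀ j → cvtx j ∈ₛ cedg j
    here j with lastView j
    ... | last    = close₁
    ... | inner i = cleft∈ i
    there : ∀ j → cvtx (next j) ∈ₛ cedg j
    there j with lastView j
    ... | last    = close₂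
    ... | inner i = cright∈ i

  rotate : ∀ {k} → IndexedCycle H k → Rotation k → IndexedCycle H k
  rotate W R = record
    { vertexAt = λ x → vertexAt W (ρ R x) ; edgeAt = λ x → edgeAt W (ρ R x)
    ; vertexAt-inj = λ eq → ρ-inj R (vertexAt-inj W eq)
    ; edgeAt-inj   = λ eq → ρ-inj R (edgeAt-inj W eq)
    ; edgeAt-in    = λ x → edgeAt-in W (ρ R x)
    ; here∈        = λ x → here∈ W (ρ R x)
    ; next∈        = λ x → subst (λ y → vertexAt W y ∈ₛ edgeAt W (ρ R x))
                                 (sym (ρ-next R x)) (next∈ W (ρ R x)) }

  OnCycle : ∀ {k} → IndexedCycle H k → Fin n → Set
  OnCycle W x = ∃ λ j → vertexAt W j ≡ x

  onCycle? : ∀ {k} (W : IndexedCycle H k) (x : Fin n) → Dec (OnCycle W x)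
  onCycle? W x = any? (λ j → vertexAt W j ≟ᶠ x)

  offCycle-rotate : ∀ {k} (W : IndexedCycle H k) (R : Rotation k) {x : Fin n} →
    ¬ OnCycle W x → ¬ OnCycle (rotate W R) x
  offCycle-rotate W R x∉W (j , eq) = x∉W (ρ R j , eq)

  spanning⇒length : ∀ {k} (W : IndexedCycle H k) → (∀ x → OnCycle W x) → n ≡ suc k
  spanning⇒length W spans = cantor-schröder-bernstein position-inj (vertexAt-inj W)
    where
    position-inj : Injective _≡_ _≡_ (λ x → proj₁ (spans x))
    position-inj {x} {y} eq =
      trans (sym (proj₂ (spans x))) (trans (cong (vertexAt W) eq) (proj₂ (spans y)))

  prefixPath : ∀ {k} (W : IndexedCycle H k) (w : Fin n) (e : Subset n) →
    e ∈ₗ edges H → w ∈ₛ e → vertexAt W zero ∈ₛ e →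
    ¬ OnCycle W w → (∀ i → edgeAt W (inject₁ i) ≢ e) → BergePath H (suc k)
  prefixPath {k} W w e e∈H w∈e start∈e w∉W e-new = record
    { vtx = vertex ; edg = edge ; vtx-inj = vertex-inj ; edg-inj = edge-inj
    ; edg-in = edge-in ; left∈ = left ; right∈ = right }
    where
    vertex : Fin (suc (suc k)) → Fin n
    vertex zero    = w
    vertex (suc j) = vertexAt W j
    edge : Fin (suc k) → Subset n
    edge zero    = e
    edge (suc i) = edgeAt W (inject₁ i)
    vertex-inj : Injective _≡_ _≡_ vertex
    vertex-inj {zero}  {zero}  _  = refl
    vertex-inj {zero}  {suc j} eq = ⊥-elim (w∉W (j , sym eq))
    vertex-inj {suc i} {zero}  eq = ⊥-elim (w∉W (i , eq))
    vertex-inj {suc i} {suc j} eq = cong suc (vertexAt-inj W eq)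
    edge-inj : Injective _≡_ _≡_ edge
    edge-inj {zero}  {zero}  _  = refl
    edge-inj {zero}  {suc j} eq = ⊥-elim (e-new j (sym eq))
    edge-inj {suc i} {zero}  eq = ⊥-elim (e-new i eq)
    edge-inj {suc i} {suc j} eq = cong suc (inject₁-injective (edgeAt-inj W eq))
    edge-in : ∀ i → edge i ∈ₗ edges H
    edge-in zero    = e∈H
    edge-in (suc i) = edgeAt-in W (inject₁ i)
    left : ∀ i → vertex (inject₁ i) ∈ₛ edge i
    left zero    = w∈e
    left (suc i) = here∈ W (inject₁ i)
    right : ∀ i → vertex (suc i) ∈ₛ edge i
    right zero    = start∈e
    right (suc i) = subst (λ y → vertexAt W y ∈ₛ edgeAt W (inject₁ i))
                          (next-inject₁ i) (next∈ W (inject₁ i))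

  -- If e is the cycle
  -- edge at position j', start at next j' so that e is the edge left
  -- out; otherwise start at j.
  attach : ∀ {k} (W : IndexedCycle H k) (w : Fin n) (j : Fin (suc k)) (e : Subset n) →
    e ∈ₗ edges H → w ∈ₛ e → vertexAt W j ∈ₛ e → ¬ OnCycle W w → BergePath H (suc k)
  attach {k} W w j e e∈H w∈e v∈e w∉W with any? (λ j' → ≡-dec _≟ᵇ_ (edgeAt W j') e)
  ... | yes (j' , refl) =
    prefixPath (rotate W R) w (edgeAt W j') e∈H w∈e start∈e
      (offCycle-rotate W R w∉W) e-skipped
    where
    R : Rotation k
    R = proj₁ (rotationTo (next j'))
    starts-after : ρ R zero ≡ next j'
    starts-after = proj₂ (rotationTo (next j'))
    start∈e : vertexAt W (ρ R zero) ∈ₛ edgeAt W j'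
    start∈e = subst (λ y → vertexAt W y ∈ₛ edgeAt W j') (sym starts-after) (next∈ W j')
    -- The only position mapped to j' by R is the last one.
    e-skipped : ∀ i → edgeAt W (ρ R (inject₁ i)) ≢ edgeAt W j'
    e-skipped i eq with ρ-inj R (begin
        ρ R (suc i)             ≡⟨ cong (ρ R) (sym (next-inject₁ i)) ⟩
        ρ R (next (inject₁ i))  ≡⟨ ρ-next R (inject₁ i) ⟩
        next (ρ R (inject₁ i))  ≡⟨ cong next (edgeAt-inj W eq) ⟩
        next j'                 ≡⟨ sym starts-after ⟩
        ρ R zero                ∎)
      where open ≡-Reasoning
    ... | ()
  ... | no e∉W =
    prefixPath (rotate W R) w e e∈H w∈e start∈e (offCycle-rotate W R w∉W)
      (λ i eq → e∉W (ρ R (inject₁ i) , eq))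
    where
    R : Rotation k
    R = proj₁ (rotationTo j)
    start∈e : vertexAt W (ρ R zero) ∈ₛ e
    start∈e = subst (λ y → vertexAt W y ∈ₛ e) (sym (proj₂ (rotationTo j))) v∈e

  -- In a connected r-graph an indexed cycle either passes through every
  -- vertex or yields a Berge path as long as the cycle: follow a Berge
  -- path from a vertex off the cycle to the cycle, up to its first edge
  -- entering the cycle, and attach that edge.
  spanning-or-longPath : Connected H → ∀ {k} (W : IndexedCycle H k) →
    (∀ x → OnCycle W x) ⊎ BergePath H (suc k)
  spanning-or-longPath conn W with all? (onCycle? W)
  ... | yes spans = inj₁ spans
  ... | no ¬spans with ¬∀⟶∃¬ n (OnCycle W) (onCycle? W) ¬spans
  ... | u , u∉W with conn u (vertexAt W zero)
  ... | t , Q , starts-at-u , ends-on-W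
    with firstEntry (onCycle? W) t (vtx Q)
           (subst (λ x → ¬ OnCycle W x) (sym starts-at-u) u∉W) (zero , sym ends-on-W)
  ... | i , off , (j , on) =
    inj₂ (attach W (vtx Q (inject₁ i)) j (edg Q i) (edg-in Q i) (left∈ Q i)
                 (subst (_∈ₛ edg Q i) (sym on) (right∈ Q i)) off)

-- Lemma 2.1.  Apply the dichotomy to a longest cycle C: a Berge path of
-- length c(H) contradicts ℓ(H) + 1 ≤ c(H), so C passes through every vertex.
lemma2p1 : ∀ (n r : ℕ) (H : RGraph n r) → Connected H →
    ∀ (ℓ c : ℕ) → IsLongestPathLength H ℓ → IsLongestCycleLength H c →
    ℓ + 1 ≤ c → n ≡ c
lemma2p1 n r H conn ℓ c (_ , longest) (C , _) ℓ+1≤c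
  with spanning-or-longPath conn (indexCycle C)
... | inj₁ spans = trans (spanning⇒length (indexCycle C) spans) (sym (BergeCycle.len C))
... | inj₂ Q     = ⊥-elim (<⇒≱ ℓ<c (longest _ Q))
  where
  ℓ<c : ℓ < suc (BergeCycle.k C)
  ℓ<c = subst₂ _≤_ (+-comm ℓ 1) (BergeCycle.len C) ℓ+1≤c
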